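{- Let $\sigma\in\mathfrak B_d$ and let $\mathrm{supp}(\sigma)=\{S_0,S_1,-S_1,\dots,S_k,-S_k\}$. Then $$\mathrm{exc}_B(\sigma)=\mathrm{exc}_B(\sigma|_{S_0})+\mathrm{exc}_\prec(\sigma|_{S_1})+\cdots+\mathrm{exc}_\prec(\sigma|_{S_k}).$$
   Context: $\mathfrak B_d$ is the group of bijections $\sigma$ of $[\pm d]=\{\pm1,\dots,\pm d\}$ with $\sigma(-i)=-\sigma(i)$. For such $\sigma$, $\mathrm{supp}(\sigma)$ is the signed set partition obtained from the cycle decomposition of $\sigma$ on $[\pm d]$ as follows: $S_0$ is the union of all cycles containing both some $i$ and $-i$ (possibly empty), and the remaining cycles come in pairs $S_i,-S_i$ ($-S=\{ -x:x\in S\}$). For a subset $K_0\subseteq[d]$ and a bijection $\tau$ of $\pm K_0$ with $\tau(-i)=-\tau(i)$, $\mathrm{exc}_B(\tau)=|\{i\in K_0:\tau(i)>i\}|+\lfloor(|\{i\in K_0:\tau(i)<0\}|+1)/2\rfloor$ (and $\mathrm{exc}_B=0$ if $K_0=\emptyset$); in particular this defines $\mathrm{exc}_B(\sigma)$ ($K_0=[d]$) and $\mathrm{exc}_B(\sigma|_{S_0})$ ($K_0=S_0\cap[d]$). For $i\ge1$, $\sigma|_{S_i}$ is a cyclic permutation of $S_i$, and on any subset $S\subseteq[\pm d]$ with $S\cap-S=\emptyset$ the total order $\prec$ is: $i\prec j$ iff $0<i<j$, or $i<0<j$, or $j<i<0$. Then $\mathrm{exc}_\prec(\sigma|_{S_i})=|\{j\in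 S_i: j\prec\sigma(j)\}|$. -}

module Defs where

open import Data.Bool using (Bool; true; false; not; _∧_; if_then_else_)
open import Data.Nat using (ℕ; zero; suc; _+_)
open import Data.Nat.DivMod using (_/_)
open import Data.Fin using (Fin; toℕ)
open import Data.Integer as ℤ using (ℤ; +_; -[1+_])
open import Data.Nat.ListAction using (sum)
open import Data.List using (List; map; cartesianProduct; allFin; _∷_; [])
open import Data.Product using (_×_; _,_; ∃)
open import Function using (_∘_)
open import Function.Bundles using (_↔_; Inverse)
open import Relation.Binary.PropositionalEquality using (_≡_)
open import Relation.Nullary using (does)

-- An element of [±d]: (b , i) stands for -(i+1) if b = true, and +(i+1) if b = false.
SElt : ℕ → Set
SElt d = Bool × Fin d

val : ∀ {d} → SElt d → ℤ
val (false , i) = + suc (toℕ i)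
val (true  , i) = -[1+ toℕ i ]

neg : ∀ {d} → SElt d → SElt d
neg (b , i) = (not b , i)

pos : ∀ {d} → Fin d → SElt d
pos i = (false , i)

record Bd (d : ℕ) : Set where
  field
    perm : SElt d ↔ SElt d
    odd  : ∀ x → Inverse.to perm (neg x) ≡ neg (Inverse.to perm x)

app : ∀ {d} → Bd d → SElt d → SElt d
app σ = Inverse.to (Bd.perm σ)

iter : ∀ {A : Set} → (A → A) → ℕ → A → A
iter f zero    x = x
iter f (suc n) x = f (iter f n x)

sameCycle : ∀ {d} → Bd d → SElt d → SElt d → Set
sameCycle σ x y = ∃ λ n → iter (app σ) n x ≡ y

allElts : ∀ d → List (SElt d)
allElts d = cartesianProduct (true ∷ false ∷ []) (allFin d)

count : ∀ {d} → (SElt d → Bool) → ℕ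
count {d} P = sum (map (λ x → if P x then 1 else 0) (allElts d))

countFin : ∀ {d} → (Fin d → Bool) → ℕ
countFin {d} P = sum (map (λ i → if P i then 1 else 0) (allFin d))

-- exc_B of the restriction of σ to ±K₀, K₀ ⊆ [d] given by a Bool predicate
excBOn : ∀ {d} → Bd d → (Fin d → Bool) → ℕ
excBOn σ K =
  countFin (λ i → K i ∧ does (val (pos i) ℤ.<? val (app σ (pos i))))
  + (countFin (λ i → K i ∧ does (val (app σ (pos i)) ℤ.<? + 0)) + 1) / 2

excB : ∀ {d} → Bd d → ℕ
excB σ = excBOn σ (λ _ → true)

_≺ᵇ_ : ℤ → ℤ → Bool
i ≺ᵇ j with does (+ 0 ℤ.<? i) | does (+ 0 ℤ.<? j)
... | true  | true  = does (i ℤ.<? j)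
... | true  | false = false
... | false | true  = true
... | false | false = does (j ℤ.<? i)

excPrec : ∀ {d} → Bd d → (SElt d → Bool) → ℕ
excPrec σ S = count (λ x → S x ∧ (val x ≺ᵇ val (app σ x)))

-- Each i ∈ [d] satisfies exactly one of: ±i ∈ S₀, i ∈ ⋃S, -i ∈ ⋃S, where ⋃S = S₁ ∪ … ∪ Sₖ is
-- σ-invariant. For i ∈ ⋃S, i ≺ σ(i) iff i < σ(i); for -i ∈ ⋃S, -i ≺ σ(-i) iff i < σ(i) or
-- σ(-i) > 0. Hence Σⱼ exc≺(σ|Sⱼ) counts the ordinary excedances i ∉ S₀ plus the r elements -i ∈ ⋃S
-- that σ sends to a positive. The negative values σ(i) with i ∉ S₀ are those r plus the r' elements
-- i ∈ ⋃S that σ sends to a negative. Since σ permutes ⋃S, as many elements of ⋃S change sign from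
-- positive to negative as back, so r' = r, and with n₀ the number of negative σ(i), i ∈ S₀,
-- ⌊(n₀ + 2r + 1)/2⌋ = ⌊(n₀ + 1)/2⌋ + r.
module Submission where

open import Defs
open import Data.Bool using (Bool; true; false; not; _∧_; if_then_else_)
open import Data.Bool.Properties using (¬-not; ⇔→≡; T-≡)
open import Data.Nat using (ℕ; _+_; zero; suc; _*_)
open import Data.Nat.Properties using (+-comm; +-identityʳ; +-cancelˡ-≡; +-commutativeSemigroup)
open import Algebra.Properties.CommutativeSemigroup +-commutativeSemigroup using (interchange)
open import Data.Nat.DivMod using (_/_; +-distrib-/-∣ʳ; m*n/n≡m)
open import Data.Nat.Divisibility using (divides-refl)
open import Data.Nat.ListAction using (sum)
open import Data.Nat.ListAction.Properties using (sum-++; sum-↭)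
open import Data.Nat.Tactic.RingSolver using (solve-∀)
open import Data.Fin using (Fin)
import Data.Integer as ℤ
open import Data.List using (List; []; _∷_; _++_; map; allFin)
open import Data.Bool.ListAction using (any)
open import Data.List.Properties using (map-cong; map-∘; map-++)
open import Data.List.Membership.Propositional using (_∈_; lose; find)
open import Data.List.Membership.Propositional.Properties
  using (∈-allFin; ∈-map⁺; ∈-cartesianProduct⁺)
open import Data.List.Membership.Propositional.Properties.WithK using (unique∧set⇒bag)
open import Data.List.Relation.Unary.Any using (here; there)
open import Data.List.Relation.Unary.Any.Properties using (any⁺; any⁻)
import Data.List.Relation.Unary.All as All
open import Data.List.Relation.Unary.AllPairs as AllPairs using (_∷_)
open import Data.List.Relation.Unary.Unique.Propositional using (Unique)
import Data.List.Relation.Unary.Unique.Propositional.Properties as Unique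
open import Data.List.Relation.Binary.BagAndSetEquality using (∼bag⇒↭)
open import Data.List.Relation.Binary.Permutation.Propositional using (_↭_)
import Data.List.Relation.Binary.Permutation.Propositional.Properties as ↭
open import Data.Product using (_×_; ∃; Σ; _,_; proj₁; proj₂)
open import Data.Empty using (⊥; ⊥-elim)
open import Data.Sum using (_⊎_; inj₁; inj₂)
open import Function using (_∘_; mk⇔)
open import Function.Bundles using (_↔_; Inverse; Injection; Equivalence)
open import Function.Properties.Inverse using (Inverse⇒Injection)
open import Relation.Binary.PropositionalEquality
open import Relation.Nullary using (does)

-- Written exactly as the indicator in Defs, so that count P is definitionally ∑ over ⟦ P x ⟧.
⟦_⟧ : Bool → ℕ
⟦ b ⟧ = if b then 1 else 0

∑ : {A : Set} → List A → (A → ℕ) → ℕ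
∑ xs f = sum (map f xs)

∑-cong : {A : Set} (xs : List A) {f g : A → ℕ} → (∀ x → f x ≡ g x) → ∑ xs f ≡ ∑ xs g
∑-cong xs f≗g = cong sum (map-cong f≗g xs)

∑-zero : {A : Set} (xs : List A) → ∑ xs (λ _ → 0) ≡ 0
∑-zero []       = refl
∑-zero (x ∷ xs) = ∑-zero xs

∑-+ : {A : Set} (xs : List A) (f g : A → ℕ) → ∑ xs (λ x → f x + g x) ≡ ∑ xs f + ∑ xs g
∑-+ []       f g = refl
∑-+ (x ∷ xs) f g = trans (cong (f x + g x +_) (∑-+ xs f g)) (interchange (f x) (g x) (∑ xs f) (∑ xs g))

∑-++ : {A : Set} (xs ys : List A) (f : A → ℕ) → ∑ (xs ++ ys) f ≡ ∑ xs f + ∑ ys f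
∑-++ xs ys f = trans (cong sum (map-++ f xs ys)) (sum-++ (map f xs) (map f ys))

∑-map : {A B : Set} (xs : List A) (g : A → B) (f : B → ℕ) → ∑ (map g xs) f ≡ ∑ xs (f ∘ g)
∑-map xs g f = cong sum (sym (map-∘ xs))

∑-swap : {A B : Set} (xs : List A) (ys : List B) (f : A → B → ℕ)
  → ∑ xs (λ x → ∑ ys (f x)) ≡ ∑ ys (λ y → ∑ xs (λ x → f x y))
∑-swap []       ys f = sym (∑-zero ys)
∑-swap (x ∷ xs) ys f =
  trans (cong (∑ ys (f x) +_) (∑-swap xs ys f)) (sym (∑-+ ys (f x) (λ y → ∑ xs (λ x → f x y))))

any-≡true⁺ : {A : Set} (p : A → Bool) {x : A} {xs : List A} → x ∈ xs → p x ≡ true → any p xs ≡ true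
any-≡true⁺ p x∈xs px = Equivalence.to T-≡ (any⁺ p (lose x∈xs (Equivalence.from T-≡ px)))

any-≡true⁻ : {A : Set} (p : A → Bool) (xs : List A) → any p xs ≡ true → ∃ λ x → x ∈ xs × p x ≡ true
any-≡true⁻ p xs anyp with x , x∈xs , px ← find (any⁻ p xs (Equivalence.from T-≡ anyp)) =
  x , x∈xs , Equivalence.to T-≡ px

∑-indicator-any : {A : Set} (p : A → Bool) (b : Bool) {xs : List A} → Unique xs
  → (∀ {x y} → x ∈ xs → y ∈ xs → p x ≡ true → p y ≡ true → x ≡ y)
  → ∑ xs (λ x → ⟦ p x ∧ b ⟧) ≡ ⟦ any p xs ∧ b ⟧
∑-indicator-any p b {[]}     _                  _         = refl
∑-indicator-any p b {x ∷ xs} (x∉xs ∷ unique) atMostOne with p x in px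
... | false = ∑-indicator-any p b unique (λ y∈ z∈ → atMostOne (there y∈) (there z∈))
... | true  = trans (cong (⟦ b ⟧ +_) (trans rest (cong (λ c → ⟦ c ∧ b ⟧) none))) (+-identityʳ ⟦ b ⟧)
  where
  rest : ∑ xs (λ y → ⟦ p y ∧ b ⟧) ≡ ⟦ any p xs ∧ b ⟧
  rest = ∑-indicator-any p b unique (λ y∈ z∈ → atMostOne (there y∈) (there z∈))
  none : any p xs ≡ false
  none = ¬-not λ anyp → let y , y∈xs , py = any-≡true⁻ p xs anyp in
    All.lookup x∉xs y∈xs (atMostOne (here refl) (there y∈xs) px py)

indicator-split : (c b : Bool) → ⟦ b ⟧ ≡ ⟦ c ∧ b ⟧ + ⟦ not c ∧ b ⟧
indicator-split true  b = sym (+-identityʳ ⟦ b ⟧)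
indicator-split false b = refl

indicator-split-∧ : (a c b : Bool) → ⟦ a ∧ b ⟧ ≡ ⟦ a ∧ (c ∧ b) ⟧ + ⟦ a ∧ (not c ∧ b) ⟧
indicator-split-∧ true  c b = indicator-split c b
indicator-split-∧ false c b = refl

module _ {A : Set} {xs : List A} (unique : Unique xs) (complete : ∀ x → x ∈ xs) (π : A ↔ A) where
  open Inverse π using (to; from; strictlyInverseˡ)

  map-↭ : map to xs ↭ xs
  map-↭ = ∼bag⇒↭ (unique∧set⇒bag (Unique.map⁺ (Injection.injective (Inverse⇒Injection π)) unique) unique
    λ {x} → mk⇔ (λ _ → complete x)
                (λ _ → subst (_∈ map to xs) (strictlyInverseˡ x) (∈-map⁺ to (complete (from x)))))

  ∑-reindex : (f : A → ℕ) → ∑ xs (f ∘ to) ≡ ∑ xs f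
  ∑-reindex f = trans (sym (∑-map xs to f)) (sum-↭ (↭.map⁺ f map-↭))

  ∑-leaving≡∑-entering : (U Q : A → Bool) → (∀ x → U (to x) ≡ U x)
    → ∑ xs (λ x → ⟦ Q x ∧ (not (Q (to x)) ∧ U x) ⟧) ≡ ∑ xs (λ x → ⟦ not (Q x) ∧ (Q (to x) ∧ U x) ⟧)
  ∑-leaving≡∑-entering U Q invariant = +-cancelˡ-≡ (∑ xs staying) _ _ (begin
    ∑ xs staying + ∑ xs leaving
      ≡⟨ ∑-+ xs staying leaving ⟨
    ∑ xs (λ x → staying x + leaving x)
      ≡⟨ ∑-cong xs (λ x → indicator-split-∧ (Q x) (Q (to x)) (U x)) ⟨
    ∑ xs (λ x → ⟦ Q x ∧ U x ⟧)
      ≡⟨ ∑-reindex (λ x → ⟦ Q x ∧ U x ⟧) ⟨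
    ∑ xs (λ x → ⟦ Q (to x) ∧ U (to x) ⟧)
      ≡⟨ ∑-cong xs (λ x → cong (λ u → ⟦ Q (to x) ∧ u ⟧) (invariant x)) ⟩
    ∑ xs (λ x → ⟦ Q (to x) ∧ U x ⟧)
      ≡⟨ ∑-cong xs (λ x → indicator-split (Q x) (Q (to x) ∧ U x)) ⟩
    ∑ xs (λ x → staying x + entering x)
      ≡⟨ ∑-+ xs staying entering ⟩
    ∑ xs staying + ∑ xs entering ∎)
    where
    open ≡-Reasoning
    staying leaving entering : A → ℕ
    staying  x = ⟦ Q x ∧ (Q (to x) ∧ U x) ⟧
    leaving  x = ⟦ Q x ∧ (not (Q (to x)) ∧ U x) ⟧
    entering x = ⟦ not (Q x) ∧ (Q (to x) ∧ U x) ⟧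

allElts-unique : ∀ d → Unique (allElts d)
allElts-unique d =
  Unique.cartesianProduct⁺ (((λ ()) All.∷ All.[]) ∷ All.[] ∷ AllPairs.[]) (Unique.allFin⁺ d)

∈-allElts : ∀ {d} (x : SElt d) → x ∈ allElts d
∈-allElts (true  , i) = ∈-cartesianProduct⁺ {xs = true ∷ false ∷ []} (here refl) (∈-allFin i)
∈-allElts (false , i) = ∈-cartesianProduct⁺ {xs = true ∷ false ∷ []} (there (here refl)) (∈-allFin i)

∑ᵢ : ∀ {d} → (Fin d → ℕ) → ℕ
∑ᵢ {d} = ∑ (allFin d)

∑ₓ : ∀ {d} → (SElt d → ℕ) → ℕ
∑ₓ {d} = ∑ (allElts d)

∑-allElts : ∀ {d} (f : SElt d → ℕ) → ∑ₓ f ≡ ∑ᵢ (f ∘ neg ∘ pos) + ∑ᵢ (f ∘ pos)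
∑-allElts {d} f = begin
  ∑ (negatives ++ positives ++ []) f          ≡⟨ ∑-++ negatives _ f ⟩
  ∑ negatives f + ∑ (positives ++ []) f       ≡⟨ cong (∑ negatives f +_) (∑-++ positives [] f) ⟩
  ∑ negatives f + (∑ positives f + 0)         ≡⟨ cong (∑ negatives f +_) (+-identityʳ _) ⟩
  ∑ negatives f + ∑ positives f               ≡⟨ cong₂ _+_ (∑-map (allFin d) _ f) (∑-map (allFin d) _ f) ⟩
  ∑ᵢ (f ∘ neg ∘ pos) + ∑ᵢ (f ∘ pos)           ∎
  where
  open ≡-Reasoning
  negatives positives : List (SElt d)
  negatives = map (true ,_) (allFin d)
  positives = map (false ,_) (allFin d)

[n+2r+1]/2≡[n+1]/2+r : ∀ n r → (n + (r + r) + 1) / 2 ≡ (n + 1) / 2 + r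
[n+2r+1]/2≡[n+1]/2+r n r = begin
  (n + (r + r) + 1) / 2   ≡⟨ cong (_/ 2) (rearrange n r) ⟩
  (n + 1 + r * 2) / 2     ≡⟨ +-distrib-/-∣ʳ (n + 1) (divides-refl r) ⟩
  (n + 1) / 2 + r * 2 / 2 ≡⟨ cong ((n + 1) / 2 +_) (m*n/n≡m r 2) ⟩
  (n + 1) / 2 + r         ∎
  where
  open ≡-Reasoning
  rearrange : ∀ n r → n + (r + r) + 1 ≡ n + 1 + r * 2
  rearrange = solve-∀

data OneOf3 : Bool → Bool → Bool → Set where
  first  : OneOf3 true false false
  second : OneOf3 false true false
  third  : OneOf3 false false true

-- Below, y = σ(i) and y' = σ(-i), and s, u⁺, u⁻ record whether i ∈ S₀, i ∈ ⋃S, -i ∈ ⋃S.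
≺-excedances-at-± : ∀ {d} (i : Fin d) (y y' : SElt d) {s u⁺ u⁻ : Bool} → y' ≡ neg y → OneOf3 s u⁺ u⁻
  → ⟦ u⁺ ∧ (val (pos i) ≺ᵇ val y) ⟧ + ⟦ u⁻ ∧ (val (neg (pos i)) ≺ᵇ val y') ⟧
    ≡ ⟦ not s ∧ does (val (pos i) ℤ.<? val y) ⟧ + ⟦ not (proj₁ y') ∧ u⁻ ⟧
≺-excedances-at-± i (true  , j) _ refl first  = refl
≺-excedances-at-± i (false , j) _ refl first  = refl
≺-excedances-at-± i (true  , j) _ refl second = refl
≺-excedances-at-± i (false , j) _ refl second = refl
≺-excedances-at-± i (true  , j) _ refl third  = refl
≺-excedances-at-± i (false , j) _ refl third  = sym (+-identityʳ _)

negative-at : ∀ {d} (y y' : SElt d) {s u⁺ u⁻ : Bool} → y' ≡ neg y → OneOf3 s u⁺ u⁻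
  → ⟦ does (val y ℤ.<? ℤ.+ 0) ⟧
    ≡ ⟦ s ∧ does (val y ℤ.<? ℤ.+ 0) ⟧ + (⟦ proj₁ y ∧ u⁺ ⟧ + ⟦ not (proj₁ y') ∧ u⁻ ⟧)
negative-at (true  , j) _ refl first  = refl
negative-at (false , j) _ refl first  = refl
negative-at (true  , j) _ refl second = refl
negative-at (false , j) _ refl second = refl
negative-at (true  , j) _ refl third  = refl
negative-at (false , j) _ refl third  = refl

iter-commute : {A : Set} (f : A → A) (m : ℕ) (x : A) → iter f m (f x) ≡ f (iter f m x)
iter-commute f zero    x = refl
iter-commute f (suc m) x = cong f (iter-commute f m x)

module _ {d : ℕ} (σ : Bd d) where

  iter-neg : ∀ m x → iter (app σ) m (neg x) ≡ neg (iter (app σ) m x)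
  iter-neg zero    x = refl
  iter-neg (suc m) x = trans (cong (app σ) (iter-neg m x)) (Bd.odd σ (iter (app σ) m x))

  sameCycle-step : ∀ x → sameCycle σ x (app σ x)
  sameCycle-step x = 1 , refl

  sameCycle-neg : ∀ {x y} → sameCycle σ x y → sameCycle σ (neg x) (neg y)
  sameCycle-neg {x} (m , eq) = m , trans (iter-neg m x) (cong neg eq)

  sameCycle-app : ∀ {x y} → sameCycle σ x y → sameCycle σ (app σ x) (app σ y)
  sameCycle-app {x} (m , eq) = m , trans (iter-commute (app σ) m x) (cong (app σ) eq)

module Decomposition {d : ℕ} (σ : Bd d) (S₀ : SElt d → Bool) {k : ℕ} (S : Fin k → SElt d → Bool)
    (S₀⇒sameCycle : ∀ x → S₀ x ≡ true → sameCycle σ x (neg x))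
    (S-closed : ∀ j x y → S j x ≡ true → sameCycle σ x y → S j y ≡ true)
    (S-disjoint : ∀ j j' x → S j x ≡ true → S j' x ≡ true → j ≡ j')
    (S-neg-disjoint : ∀ j j' x → S j x ≡ true → S j' (neg x) ≡ true → ⊥)
    (S-cover : ∀ x → S₀ x ≡ false → Σ (Fin k) λ j → (S j x ≡ true) ⊎ (S j (neg x) ≡ true))
  where

  ⋃S : SElt d → Bool
  ⋃S x = any (λ j → S j x) (allFin k)

  ⋃S-intro : ∀ j {x} → S j x ≡ true → ⋃S x ≡ true
  ⋃S-intro j {x} = any-≡true⁺ (λ j → S j x) (∈-allFin j)

  ⋃S-witness : ∀ {x} → ⋃S x ≡ true → ∃ λ j → S j x ≡ true
  ⋃S-witness {x} ux with j , _ , sjx ← any-≡true⁻ (λ j → S j x) (allFin k) ux = j , sjx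

  ⋃S-false-if-sameCycle-neg : ∀ x → sameCycle σ x (neg x) → ⋃S x ≡ false
  ⋃S-false-if-sameCycle-neg x cyc = ¬-not λ ux → let j , sjx = ⋃S-witness ux in
    S-neg-disjoint j j x sjx (S-closed j x (neg x) sjx cyc)

  ⋃S-neg-disjoint : ∀ x → ⋃S x ≡ true → ⋃S (neg x) ≡ true → ⊥
  ⋃S-neg-disjoint x ux unx = let j , sjx = ⋃S-witness ux; j' , sj'nx = ⋃S-witness unx in
    S-neg-disjoint j j' x sjx sj'nx

  exactly-one : ∀ x → OneOf3 (S₀ x) (⋃S x) (⋃S (neg x))
  exactly-one x with S₀ x in s₀x
  ... | true
    rewrite ⋃S-false-if-sameCycle-neg x (S₀⇒sameCycle x s₀x)
          | ⋃S-false-if-sameCycle-neg (neg x) (sameCycle-neg σ (S₀⇒sameCycle x s₀x)) = first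
  ... | false with S-cover x s₀x
  ...   | j , inj₁ sjx
    rewrite ⋃S-intro j sjx | ¬-not (⋃S-neg-disjoint x (⋃S-intro j sjx)) = second
  ...   | j , inj₂ sjnx
    rewrite ⋃S-intro j sjnx | ¬-not (λ ux → ⋃S-neg-disjoint x ux (⋃S-intro j sjnx)) = third

  -- The backward direction needs no finiteness of orbits: if σ(x) ∈ Sⱼ, then x ∉ S₀ (else σ(x)
  -- would share a cycle with -σ(x)), and -x ∈ Sⱼ' would force -σ(x) ∈ Sⱼ'; so x ∈ ⋃S by the cover.
  ⋃S-invariant : ∀ x → ⋃S (app σ x) ≡ ⋃S x
  ⋃S-invariant x = ⇔→≡ (mk⇔ backward forward)
    where
    forward : ⋃S x ≡ true → ⋃S (app σ x) ≡ true
    forward ux = let j , sjx = ⋃S-witness ux in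
      ⋃S-intro j (S-closed j x (app σ x) sjx (sameCycle-step σ x))

    backward : ⋃S (app σ x) ≡ true → ⋃S x ≡ true
    backward uσx with j , sjσx ← ⋃S-witness uσx | S₀ x in s₀x
    ... | true = ⊥-elim (S-neg-disjoint j j (app σ x) sjσx (S-closed j _ _ sjσx σx~-σx))
      where
      σx~-σx : sameCycle σ (app σ x) (neg (app σ x))
      σx~-σx = subst (sameCycle σ (app σ x)) (Bd.odd σ x) (sameCycle-app σ (S₀⇒sameCycle x s₀x))
    ... | false with S-cover x s₀x
    ...   | j' , inj₁ sj'x  = ⋃S-intro j' sj'x
    ...   | j' , inj₂ sj'-x = ⊥-elim (S-neg-disjoint j j' (app σ x) sjσx sj'-σx)
      where
      sj'-σx : S j' (neg (app σ x)) ≡ true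
      sj'-σx = subst (λ z → S j' z ≡ true) (Bd.odd σ x)
                     (S-closed j' _ _ sj'-x (sameCycle-step σ (neg x)))

  ∑excPrec≡∑⋃S : sum (map (λ j → excPrec σ (S j)) (allFin k))
               ≡ ∑ₓ (λ x → ⟦ ⋃S x ∧ (val x ≺ᵇ val (app σ x)) ⟧)
  ∑excPrec≡∑⋃S =
    trans (∑-swap (allFin k) (allElts d) (λ j x → ⟦ S j x ∧ (val x ≺ᵇ val (app σ x)) ⟧))
          (∑-cong (allElts d) λ x →
            ∑-indicator-any (λ j → S j x) _ (Unique.allFin⁺ k) λ _ _ → S-disjoint _ _ x)

  toNegative toPositive : Fin d → ℕ
  toNegative i = ⟦ proj₁ (app σ (pos i)) ∧ ⋃S (pos i) ⟧
  toPositive i = ⟦ not (proj₁ (app σ (neg (pos i)))) ∧ ⋃S (neg (pos i)) ⟧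

  ∑toNegative≡∑toPositive : ∑ᵢ toNegative ≡ ∑ᵢ toPositive
  ∑toNegative≡∑toPositive = begin
    ∑ᵢ toNegative                    ≡⟨ cong (_+ ∑ᵢ toNegative) (∑-zero (allFin d)) ⟨
    ∑ᵢ {d} (λ _ → 0) + ∑ᵢ toNegative ≡⟨ ∑-allElts entering ⟨
    ∑ₓ entering
      ≡⟨ ∑-leaving≡∑-entering (allElts-unique d) ∈-allElts (Bd.perm σ) ⋃S proj₁ ⋃S-invariant ⟨
    ∑ₓ leaving                       ≡⟨ ∑-allElts leaving ⟩
    ∑ᵢ toPositive + ∑ᵢ {d} (λ _ → 0) ≡⟨ cong (∑ᵢ toPositive +_) (∑-zero (allFin d)) ⟩
    ∑ᵢ toPositive + 0                ≡⟨ +-identityʳ _ ⟩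
    ∑ᵢ toPositive                    ∎
    where
    open ≡-Reasoning
    leaving entering : SElt d → ℕ
    leaving  x = ⟦ proj₁ x ∧ (not (proj₁ (app σ x)) ∧ ⋃S x) ⟧
    entering x = ⟦ not (proj₁ x) ∧ (proj₁ (app σ x) ∧ ⋃S x) ⟧

  isExc isNeg : Fin d → Bool
  isExc i = does (val (pos i) ℤ.<? val (app σ (pos i)))
  isNeg i = does (val (app σ (pos i)) ℤ.<? ℤ.+ 0)

  inS₀ offS₀ : (Fin d → Bool) → Fin d → ℕ
  inS₀  P i = ⟦ S₀ (pos i) ∧ P i ⟧
  offS₀ P i = ⟦ not (S₀ (pos i)) ∧ P i ⟧

  ∑isExc-split : ∑ᵢ (⟦_⟧ ∘ isExc) ≡ ∑ᵢ (inS₀ isExc) + ∑ᵢ (offS₀ isExc)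
  ∑isExc-split =
    trans (∑-cong (allFin d) λ i → indicator-split (S₀ (pos i)) (isExc i)) (∑-+ (allFin d) _ _)

  ∑isNeg-split : ∑ᵢ (⟦_⟧ ∘ isNeg) ≡ ∑ᵢ (inS₀ isNeg) + (∑ᵢ toNegative + ∑ᵢ toPositive)
  ∑isNeg-split = begin
    ∑ᵢ (⟦_⟧ ∘ isNeg)
      ≡⟨ ∑-cong (allFin d) (λ i → negative-at _ _ (Bd.odd σ (pos i)) (exactly-one (pos i))) ⟩
    ∑ᵢ (λ i → inS₀ isNeg i + (toNegative i + toPositive i))
      ≡⟨ ∑-+ (allFin d) _ _ ⟩
    ∑ᵢ (inS₀ isNeg) + ∑ᵢ (λ i → toNegative i + toPositive i)
      ≡⟨ cong (∑ᵢ (inS₀ isNeg) +_) (∑-+ (allFin d) toNegative toPositive) ⟩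
    ∑ᵢ (inS₀ isNeg) + (∑ᵢ toNegative + ∑ᵢ toPositive) ∎
    where open ≡-Reasoning

  ∑⋃S-≺exc-split : ∑ₓ (λ x → ⟦ ⋃S x ∧ (val x ≺ᵇ val (app σ x)) ⟧) ≡ ∑ᵢ (offS₀ isExc) + ∑ᵢ toPositive
  ∑⋃S-≺exc-split = begin
    ∑ₓ exc                                      ≡⟨ ∑-allElts exc ⟩
    ∑ᵢ (exc ∘ neg ∘ pos) + ∑ᵢ (exc ∘ pos)       ≡⟨ +-comm (∑ᵢ (exc ∘ neg ∘ pos)) _ ⟩
    ∑ᵢ (exc ∘ pos) + ∑ᵢ (exc ∘ neg ∘ pos)       ≡⟨ ∑-+ (allFin d) _ _ ⟨
    ∑ᵢ (λ i → exc (pos i) + exc (neg (pos i)))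
      ≡⟨ ∑-cong (allFin d) (λ i → ≺-excedances-at-± i _ _ (Bd.odd σ (pos i)) (exactly-one (pos i))) ⟩
    ∑ᵢ (λ i → offS₀ isExc i + toPositive i)     ≡⟨ ∑-+ (allFin d) _ _ ⟩
    ∑ᵢ (offS₀ isExc) + ∑ᵢ toPositive            ∎
    where
    open ≡-Reasoning
    exc : SElt d → ℕ
    exc x = ⟦ ⋃S x ∧ (val x ≺ᵇ val (app σ x)) ⟧

  excB-decomposition : excB σ ≡ excBOn σ (S₀ ∘ pos) + sum (map (λ j → excPrec σ (S j)) (allFin k))
  excB-decomposition = begin
    ∑ᵢ (⟦_⟧ ∘ isExc) + (∑ᵢ (⟦_⟧ ∘ isNeg) + 1) / 2
      ≡⟨ cong₂ (λ a n → a + (n + 1) / 2) ∑isExc-split ∑isNeg-split ⟩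
    a₀ + a₁ + (n₀ + (∑ᵢ toNegative + r) + 1) / 2
      ≡⟨ cong (λ t → a₀ + a₁ + (n₀ + (t + r) + 1) / 2) ∑toNegative≡∑toPositive ⟩
    a₀ + a₁ + (n₀ + (r + r) + 1) / 2
      ≡⟨ cong (a₀ + a₁ +_) ([n+2r+1]/2≡[n+1]/2+r n₀ r) ⟩
    a₀ + a₁ + ((n₀ + 1) / 2 + r)
      ≡⟨ interchange a₀ a₁ ((n₀ + 1) / 2) r ⟩
    a₀ + (n₀ + 1) / 2 + (a₁ + r)
      ≡⟨ cong (a₀ + (n₀ + 1) / 2 +_) (trans ∑excPrec≡∑⋃S ∑⋃S-≺exc-split) ⟨
    excBOn σ (S₀ ∘ pos) + sum (map (λ j → excPrec σ (S j)) (allFin k)) ∎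
    where
    open ≡-Reasoning
    a₀ a₁ n₀ r : ℕ
    a₀ = ∑ᵢ (inS₀ isExc)
    a₁ = ∑ᵢ (offS₀ isExc)
    n₀ = ∑ᵢ (inS₀ isNeg)
    r  = ∑ᵢ toPositive

propositionp : ∀ (d : ℕ) (σ : Bd d) (S₀ : SElt d → Bool) (k : ℕ) (S : Fin k → SElt d → Bool)
    -- S₀ is the union of the cycles containing some i together with -i
    → (∀ x → (S₀ x ≡ true → sameCycle σ x (neg x)) × (sameCycle σ x (neg x) → S₀ x ≡ true))
    -- each Sⱼ is a cycle of σ
    → (∀ j → ∃ λ x → S j x ≡ true)
    → (∀ j x y → S j x ≡ true → (S j y ≡ true → sameCycle σ x y) × (sameCycle σ x y → S j y ≡ true))
    -- the sets S₁, -S₁, …, Sₖ, -Sₖ are pairwise distinct (disjoint)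
    → (∀ j j' x → S j x ≡ true → S j' x ≡ true → j ≡ j')
    → (∀ j j' x → S j x ≡ true → S j' (neg x) ≡ true → ⊥)
    -- together with S₀ they cover [±d]
    → (∀ x → S₀ x ≡ false → Σ (Fin k) λ j → (S j x ≡ true) ⊎ (S j (neg x) ≡ true))
    → excB σ ≡ excBOn σ (S₀ ∘ pos) + sum (map (λ j → excPrec σ (S j)) (allFin k))
propositionp d σ S₀ k S S₀-spec _ S-spec S-disjoint S-neg-disjoint S-cover =
  Decomposition.excB-decomposition σ S₀ S
    (λ x → proj₁ (S₀-spec x)) (λ j x y sjx → proj₂ (S-spec j x y sjx)) S-disjoint S-neg-disjoint S-cover
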